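{- Let $F_1,F_2,F$ be full-dimensional tree topologies on $[N]$. If $F\in C(F_1,F_2)$, then every equivalence class $C\subseteq p_N$ with respect to $=_F$ is contained in an equivalence class with respect to $=_{F_1}$ or in an equivalence class with respect to $=_{F_2}$. Equivalently, for each $S\in\bar F=\{S\in F:|S|\ge 3\}\cup\{[N]\}$, either there exists $S_1\in F_1\cup\{[N]\}$ such that $\mathrm{cl}_F(p)=S$ implies $\mathrm{cl}_{F_1}(p)=S_1$ for all $p\in p_N$, or there exists $S_2\in F_2\cup\{[N]\}$ such that $\mathrm{cl}_F(p)=S$ implies $\mathrm{cl}_{F_2}(p)=S_2$ for all $p\in p_N$.
   Context: $p_N$ is the set of 2-element subsets of $[N]$, $n=\binom N2$. A tree topology $F$ on $[N]$ is a collection of clades $S\subseteq[N]$, $2\le|S|\le N-1$, any two distinct ones either strictly nested or disjoint; it is full dimensional if $|F|=N-2$. $F(p)=\{S\in F:S\supseteq p\}$; $\mathrm{cl}_F(p)$ is the intersection of $F(p)$ if nonempty, else $[N]$; $p_1=_F p_2$ iff $\mathrm{cl}_F(p_1)=\mathrm{cl}_F(p_2)$. An equidistant tree is a rooted tree with leaves labeled $[N]$, no non-root vertex of degree 2, positive edge lengths, all leaves at equal distance from the root; its tree metric is $w_{\{i,j\}}=$ path length between leaves $i,j$, and its tree topology is the set of leaf sets separated from the root by internal edges. $ut(F)\subseteq\mathbb{R}^n$ is the set of vectors $w$ such that $w-c\mathbf{1}$ is the tree metric of an equidistant tree with tree topology $F$ for some $c\in\mathbb{R}$. $C(F_1,F_2)$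 is the set of tree topologies $F$ for which there exist $w_1\in ut(F_1)$, $w_2\in ut(F_2)$ with the coordinatewise maximum $w_1\boxplus w_2\in ut(F)$.
   Formalization: In $F\in C(F_1,F_2)$ only rational witnesses are allowed: $w_1$, $w_2$ have rational entries rather than lying in $\mathbb{R}^n$, and the constant $c$ and the equidistant trees' edge lengths are rational. -}

module Defs where

open import Data.Nat using (ℕ; _≤_; _∸_)
open import Data.Fin using (Fin; _<_)
open import Data.Fin.Subset using (Subset; _∈_; _∉_; _⊆_; _⊂_; ⊤; ⋂; ∣_∣)
open import Data.Bool using (Bool; true; false; _∧_; if_then_else_)
open import Data.Vec using (lookup)
open import Data.List using (List; length; filter; [])
import Data.List.Membership.Propositional as LM
open import Data.List.Relation.Unary.Unique.Propositional using (Unique)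
open import Data.Product using (Σ; ∃; _×_; _,_)
open import Data.Sum using (_⊎_)
open import Relation.Binary.PropositionalEquality using (_≡_)
open import Relation.Nullary using (¬_)
open import Relation.Nullary.Decidable using (Dec; yes; no)
open import Data.Rational using (ℚ; 0ℚ; _+_; _*_; _⊔_) renaming (_<_ to _<ℚ_)

-- Elements of p_N: 2-element subsets {i,j} of [N] = Fin N, encoded as i < j.
record Pair (N : ℕ) : Set where
  constructor pair
  field
    fst : Fin N
    snd : Fin N
    fst<snd : fst < snd
open Pair public

-- Vectors in ℝ^n, n = binom N 2 (with ℚ in place of ℝ)
Vect : ℕ → Set
Vect N = Pair N → ℚ

Disjoint : {N : ℕ} → Subset N → Subset N → Set
Disjoint S T = ∀ {x} → x ∈ S → x ∉ T

record TreeTopology (N : ℕ) : Set where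
  field
    clades   : List (Subset N)
    unique   : Unique clades
    size-lo  : ∀ {S} → S LM.∈ clades → 2 ≤ ∣ S ∣
    size-hi  : ∀ {S} → S LM.∈ clades → ∣ S ∣ ≤ N ∸ 1
    laminar  : ∀ {S T} → S LM.∈ clades → T LM.∈ clades → ¬ (S ≡ T) →
               (S ⊂ T) ⊎ (T ⊂ S) ⊎ Disjoint S T
open TreeTopology public

FullDim : {N : ℕ} → TreeTopology N → Set
FullDim {N} F = length (clades F) ≡ N ∸ 2

contains : {N : ℕ} → Pair N → Subset N → Bool
contains p S = lookup S (fst p) ∧ lookup S (snd p)

-- cl_F(p): intersection of F(p) = {S ∈ F : S ⊇ p}; the empty intersection is [N] = ⊤
cl : {N : ℕ} → TreeTopology N → Pair N → Subset N
cl F p = ⋂ (filter (λ S → dec (contains p S)) (clades F))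
  where
  dec : (b : Bool) → Dec (b ≡ true)
  dec true  = yes _≡_.refl
  dec false = no (λ ())

InBar : {N : ℕ} → TreeTopology N → Subset N → Set
InBar F S = S LM.∈ clades F ⊎ S ≡ ⊤

-- ut(F): w such that w - c·1 is the tree metric of an equidistant tree with
-- topology F.  An equidistant tree with topology F is given by the heights
-- h(S) > 0 (distance to the leaves) of its internal vertices, which are indexed
-- by F ∪ {[N]} (leaves have height 0); positive edge lengths means
-- h strictly increasing along strict inclusion.  The distance of leaves i,j is
-- twice the height of their lowest common ancestor, whose leaf set is cl_F({i,j}).
InUt : {N : ℕ} → TreeTopology N → Vect N → Set
InUt F w =
  Σ ℚ λ c → Σ (Subset _ → ℚ) λ h →
    (∀ {S} → InBar F S → 0ℚ <ℚ h S) ×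
    (∀ {S T} → InBar F S → InBar F T → S ⊂ T → h S <ℚ h T) ×
    (∀ p → w p ≡ c + (h (cl F p) + h (cl F p)))

_⊞_ : {N : ℕ} → Vect N → Vect N → Vect N
(w₁ ⊞ w₂) p = w₁ p ⊔ w₂ p

InC : {N : ℕ} → TreeTopology N → TreeTopology N → TreeTopology N → Set
InC F F₁ F₂ = ∃ λ w₁ → ∃ λ w₂ → InUt F₁ w₁ × InUt F₂ w₂ × InUt F (w₁ ⊞ w₂)

_≈[_]_ : {N : ℕ} → Pair N → TreeTopology N → Pair N → Set
p ≈[ F ] q = cl F p ≡ cl F q

ClassInside : {N : ℕ} → TreeTopology N → TreeTopology N → Pair N → Set
ClassInside F G p = ∀ q → q ≈[ F ] p → q ≈[ G ] p

{-# OPTIONS --safe #-}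

-- Let w = w₁ ⊞ w₂ ∈ ut(F) and say w₁(p) = w(p). A full-dimensional F is binary, so
-- S = cl_F(p) has exactly two children, and cl_F(q) = S exactly when the endpoints of q lie
-- in different children. Replacing an endpoint x of such a pair {x, z} by a leaf y of the
-- same child keeps cl_F₁: the pair {x, y} lies below S, so w₁{x,y} ≤ w{x,y} < w(p) = w₁{x,z},
-- and in the ultrametric w₁ the two longest sides of the triangle x, y, z have the same
-- closure. Two such moves carry p to any q with cl_F(q) = S.
--
-- Binarity is a count: sending each S ∈ F ∪ {[N]} to the largest leaf of S outside the child
-- containing max S is injective and never hits max [N]. If S had a third child, the largest
-- leaf of that child would be missed as well, leaving N − 1 sets for at most N − 2 leaves.

module Submission where

open import Defs
open import Data.Nat as ℕ using (ℕ; zero; suc; z≤n; s≤s)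
import Data.Nat.Properties as ℕ
open import Data.Fin as Fin using (Fin; zero; suc; _≤_; _<_)
import Data.Fin.Properties as Fin
open import Data.Fin.Subset using (Subset; _∈_; _∉_; _⊆_; _⊂_; _∩_; ⊤; ⋂; ∣_∣; ⁅_⁆; Nonempty)
open import Data.Fin.Subset.Properties
  using (∈⊤; ⊆⊤; ⊆-refl; ⊆-trans; ⊆-antisym; ⊆-⊂-trans; ⊂-irref; _∈?_; _⊂?_; p∩q⊆p; p∩q⊆q; x∈p∩q⁺;
         ∩-identityʳ; p⊆q⇒∣p∣≤∣q∣; ∣⁅x⁆∣≡1; x∈⁅x⁆; ∣⊤∣≡n)
open import Data.Bool using (true)
import Data.Bool.Properties as Bool
import Data.Vec as Vec
open import Data.Vec.Properties using (≡-dec; []=⇒lookup; lookup⇒[]=)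
open import Data.List as List using (List; []; _∷_; filter; length)
open import Data.List.Membership.Propositional using (find; lose) renaming (_∈_ to _∈ₗ_)
open import Data.List.Membership.Propositional.Properties using (∈-filter⁺; ∈-filter⁻; ∈-lookup)
open import Data.List.Relation.Unary.Any using (Any; here; there; any?)
import Data.List.Relation.Unary.All as All
open import Data.List.Relation.Unary.AllPairs using (_∷_)
open import Data.List.Relation.Unary.Unique.Propositional using (Unique)
open import Data.Product using (∃; _×_; _,_; proj₁; proj₂)
open import Data.Sum using (_⊎_; inj₁; inj₂; [_,_]′; fromInj₂)
open import Data.Empty using (⊥-elim)
open import Data.Rational using (ℚ; _+_) renaming (_≤_ to _≤ℚ_; _<_ to _<ℚ_)
import Data.Rational.Properties as ℚ
open import Function using (_∘_)
open import Function.Definitions using (Injective)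
open import Relation.Binary.Definitions using (DecidableEquality)
open import Relation.Binary.PropositionalEquality using (_≡_; _≢_; refl; sym; trans; cong; subst; module ≡-Reasoning)
open import Relation.Nullary using (¬_; Dec; yes; no; contradiction)
open import Relation.Nullary.Decidable using (_×-dec_; _⊎-dec_; ¬?; decidable-stable)
open import Relation.Unary using (Decidable)
open import Relation.Binary using (tri<; tri≈; tri>)

_≟ₛ_ : {n : ℕ} → DecidableEquality (Subset n)
_≟ₛ_ = ≡-dec Bool._≟_

⊆∧≢⇒⊂ : {n : ℕ} {p q : Subset n} → p ⊆ q → p ≢ q → p ⊂ q
⊆∧≢⇒⊂ {n} {p} {q} p⊆q p≢q
  with Fin.¬∀⟶∃¬ n (λ x → x ∉ q ⊎ x ∈ p) (λ x → ¬? (x ∈? q) ⊎-dec x ∈? p) q⊈p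
  where
  q⊈p : ¬ (∀ x → x ∉ q ⊎ x ∈ p)
  q⊈p q⊆p = p≢q (⊆-antisym p⊆q λ {x} x∈q → fromInj₂ (contradiction x∈q) (q⊆p x))
... | x , x∉q⊎x∈p = p⊆q , x , decidable-stable (x ∈? q) (x∉q⊎x∈p ∘ inj₁) , x∉q⊎x∈p ∘ inj₂

NonSingleton : {n : ℕ} → Subset n → Set
NonSingleton S = ∀ u → ∃ λ x → x ∈ S × x ≢ u

2≤∣p∣⇒nonSingleton : {n : ℕ} {S : Subset n} → 2 ℕ.≤ ∣ S ∣ → NonSingleton S
2≤∣p∣⇒nonSingleton {n} {S} 2≤∣S∣ u
  with Fin.¬∀⟶∃¬ n (λ x → x ∉ S ⊎ x ≡ u) (λ x → ¬? (x ∈? S) ⊎-dec x Fin.≟ u) S⊈⁅u⁆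
  where
  S⊈⁅u⁆ : ¬ (∀ x → x ∉ S ⊎ x ≡ u)
  S⊈⁅u⁆ S⊆⁅u⁆ = ℕ.<⇒≱ 2≤∣S∣ (subst (∣ S ∣ ℕ.≤_) (∣⁅x⁆∣≡1 u) (p⊆q⇒∣p∣≤∣q∣ S⊆⁅u⁆′))
    where
    S⊆⁅u⁆′ : S ⊆ ⁅ u ⁆
    S⊆⁅u⁆′ {x} x∈S with fromInj₂ (contradiction x∈S) (S⊆⁅u⁆ x)
    ... | refl = x∈⁅x⁆ x
... | x , x∉S⊎x≡u = x , decidable-stable (x ∈? S) (x∉S⊎x≡u ∘ inj₁) , x∉S⊎x≡u ∘ inj₂

distinct⇒nonSingleton : {n : ℕ} {S : Subset n} {x y : Fin n} → x ∈ S → y ∈ S → x ≢ y → NonSingleton S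
distinct⇒nonSingleton {x = x} {y} x∈S y∈S x≢y u with x Fin.≟ u
... | yes refl = y , y∈S , x≢y ∘ sym
... | no x≢u   = x , x∈S , x≢u

∈-⋂⁺ : {n : ℕ} {x : Fin n} (xs : List (Subset n)) → (∀ {S} → S ∈ₗ xs → x ∈ S) → x ∈ ⋂ xs
∈-⋂⁺ []       _    = ∈⊤
∈-⋂⁺ (S ∷ xs) x∈xs = x∈p∩q⁺ (x∈xs (here refl) , ∈-⋂⁺ xs (x∈xs ∘ there))

⋂⊆ : {n : ℕ} {S : Subset n} {xs : List (Subset n)} → S ∈ₗ xs → ⋂ xs ⊆ S
⋂⊆ (here refl)  = p∩q⊆p _ _
⋂⊆ (there S∈xs) = ⊆-trans (p∩q⊆q _ _) (⋂⊆ S∈xs)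

⋂-chain : {n : ℕ} (xs : List (Subset n)) →
          (∀ {S T} → S ∈ₗ xs → T ∈ₗ xs → S ⊆ T ⊎ T ⊆ S) →
          ⋂ xs ≡ ⊤ ⊎ ⋂ xs ∈ₗ xs
⋂-chain []       _      = inj₁ refl
⋂-chain (S ∷ xs) nested with ⋂-chain xs (λ S∈ T∈ → nested (there S∈) (there T∈))
... | inj₁ ⋂xs≡⊤ = inj₂ (here (trans (cong (S ∩_) ⋂xs≡⊤) (∩-identityʳ S)))
... | inj₂ ⋂xs∈xs with nested (here refl) (there ⋂xs∈xs)
...   | inj₁ S⊆⋂xs = inj₂ (here (⊆-antisym (p∩q⊆p _ _) (λ x∈S → x∈p∩q⁺ (x∈S , S⊆⋂xs x∈S))))
...   | inj₂ ⋂xs⊆S = inj₂ (there (subst (_∈ₗ xs) ⋂xs≡S∩⋂xs ⋂xs∈xs))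
  where
  ⋂xs≡S∩⋂xs : ⋂ xs ≡ S ∩ ⋂ xs
  ⋂xs≡S∩⋂xs = ⊆-antisym (λ x∈⋂ → x∈p∩q⁺ (⋂xs⊆S x∈⋂ , x∈⋂)) (p∩q⊆q _ _)

greatest : {n : ℕ} {Q : Subset n → Set} → Decidable Q → (xs : List (Subset n)) →
           (∀ {S T} → S ∈ₗ xs → T ∈ₗ xs → Q S → Q T → S ⊆ T ⊎ T ⊆ S) →
           (∀ {S} → S ∈ₗ xs → ¬ Q S) ⊎ ∃ λ T → T ∈ₗ xs × Q T × ∀ {S} → S ∈ₗ xs → Q S → S ⊆ T
greatest Q? []       _      = inj₁ λ ()
greatest Q? (S ∷ xs) nested with greatest Q? xs (λ S∈ T∈ → nested (there S∈) (there T∈)) | Q? S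
... | inj₁ none | no ¬QS =
  inj₁ λ { (here refl) → ¬QS ; (there S∈) → none S∈ }
... | inj₁ none | yes QS =
  inj₂ (S , here refl , QS , λ { (here refl) _ → ⊆-refl ; (there R∈) QR → ⊥-elim (none R∈ QR) })
... | inj₂ (T , T∈ , QT , T-greatest) | no ¬QS =
  inj₂ (T , there T∈ , QT , λ { (here refl) QS → ⊥-elim (¬QS QS) ; (there R∈) QR → T-greatest R∈ QR })
... | inj₂ (T , T∈ , QT , T-greatest) | yes QS with nested (here refl) (there T∈) QS QT
...   | inj₁ S⊆T = inj₂ (T , there T∈ , QT , λ { (here refl) _ → S⊆T ; (there R∈) QR → T-greatest R∈ QR })
...   | inj₂ T⊆S = inj₂ (S , here refl , QS ,
                         λ { (here refl) _ → ⊆-refl ; (there R∈) QR → ⊆-trans (T-greatest R∈ QR) T⊆S })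

IsMax : {n : ℕ} → (Fin n → Set) → Fin n → Set
IsMax P m = P m × (∀ x → P x → x ≤ m)

maximum : {n : ℕ} {P : Fin n → Set} → Decidable P → ∃ P → ∃ (IsMax P)
maximum {suc n} {P} P? (x , Px) with Fin.any? (P? ∘ suc)
... | yes ∃P∘suc with maximum (P? ∘ suc) ∃P∘suc
...   | m , Pm , m-max = suc m , Pm , bound
  where
  bound : ∀ y → P y → y ≤ suc m
  bound zero    _  = z≤n
  bound (suc y) Py = s≤s (m-max y Py)
maximum {suc n} {P} P? (x , Px) | no ¬∃P∘suc = zero , P0 x Px , bound
  where
  P0 : ∀ x → P x → P zero
  P0 zero    Px = Px
  P0 (suc x) Px = ⊥-elim (¬∃P∘suc (x , Px))
  bound : ∀ y → P y → y ≤ Fin.zero {n}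
  bound zero    _  = z≤n
  bound (suc y) Py = ⊥-elim (¬∃P∘suc (y , Py))

max-unique : {n : ℕ} {P : Fin n → Set} {m m′ : Fin n} → IsMax P m → IsMax P m′ → m ≡ m′
max-unique (Pm , m-max) (Pm′ , m′-max) = Fin.≤-antisym (m′-max _ Pm) (m-max _ Pm′)

injective-avoiding-two⇒≤ : {m n : ℕ} {g : Fin m → Fin n} {a b : Fin n} →
                            Injective _≡_ _≡_ g → a ≢ b → (∀ i → g i ≢ a) → (∀ i → g i ≢ b) →
                            2 ℕ.+ m ℕ.≤ n
injective-avoiding-two⇒≤ {m} {n} {g} {a} {b} g-inj a≢b g≢a g≢b = Fin.injective⇒≤ h-inj
  where
  h : Fin (2 ℕ.+ m) → Fin n
  h zero          = a
  h (suc zero)    = b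
  h (suc (suc i)) = g i
  h-inj : Injective _≡_ _≡_ h
  h-inj {zero}        {zero}        _ = refl
  h-inj {zero}        {suc zero}    e = ⊥-elim (a≢b e)
  h-inj {zero}        {suc (suc j)} e = ⊥-elim (g≢a j (sym e))
  h-inj {suc zero}    {zero}        e = ⊥-elim (a≢b (sym e))
  h-inj {suc zero}    {suc zero}    _ = refl
  h-inj {suc zero}    {suc (suc j)} e = ⊥-elim (g≢b j (sym e))
  h-inj {suc (suc i)} {zero}        e = ⊥-elim (g≢a i e)
  h-inj {suc (suc i)} {suc zero}    e = ⊥-elim (g≢b i e)
  h-inj {suc (suc i)} {suc (suc j)} e = cong (Fin.suc ∘ Fin.suc) (g-inj e)

lookup-injective : {A : Set} {xs : List A} → Unique xs → Injective _≡_ _≡_ (List.lookup xs)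
lookup-injective {xs = x ∷ xs} (x∉xs ∷ _) {zero}  {zero}  _ = refl
lookup-injective {xs = x ∷ xs} (x∉xs ∷ _) {zero}  {suc j} e = ⊥-elim (All.lookup x∉xs (∈-lookup j) e)
lookup-injective {xs = x ∷ xs} (x∉xs ∷ _) {suc i} {zero}  e = ⊥-elim (All.lookup x∉xs (∈-lookup i) (sym e))
lookup-injective {xs = x ∷ xs} (_ ∷ xs-unique) {suc i} {suc j} e = cong suc (lookup-injective xs-unique e)

data Joins {N : ℕ} (q : Pair N) (x y : Fin N) : Set where
  forward  : fst q ≡ x → snd q ≡ y → Joins q x y
  backward : fst q ≡ y → snd q ≡ x → Joins q x y

joins-self : {N : ℕ} (q : Pair N) → Joins q (fst q) (snd q)
joins-self q = forward refl refl

joins-sym : {N : ℕ} {q : Pair N} {x y : Fin N} → Joins q x y → Joins q y x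
joins-sym (forward  q₁≡x q₂≡y) = backward q₁≡x q₂≡y
joins-sym (backward q₁≡y q₂≡x) = forward  q₁≡y q₂≡x

joins⇒≢ : {N : ℕ} {q : Pair N} {x y : Fin N} → Joins q x y → x ≢ y
joins⇒≢ {q = pair _ _ q₁<q₂} (forward refl refl) = Fin.<⇒≢ q₁<q₂
joins⇒≢ {q = pair _ _ q₁<q₂} (backward refl refl) = Fin.<⇒≢ q₁<q₂ ∘ sym

joins-injective : {N : ℕ} {q q′ : Pair N} {x y : Fin N} → Joins q x y → Joins q′ x y → q ≡ q′
joins-injective {q = pair _ _ <₁} {pair _ _ <₂} (forward refl refl) (forward refl refl) =
  cong (pair _ _) (Fin.<-irrelevant <₁ <₂)
joins-injective {q = pair _ _ <₁} {pair _ _ <₂} (forward refl refl) (backward refl refl) =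
  ⊥-elim (Fin.<-asym <₁ <₂)
joins-injective {q = pair _ _ <₁} {pair _ _ <₂} (backward refl refl) (forward refl refl) =
  ⊥-elim (Fin.<-asym <₁ <₂)
joins-injective {q = pair _ _ <₁} {pair _ _ <₂} (backward refl refl) (backward refl refl) =
  cong (pair _ _) (Fin.<-irrelevant <₁ <₂)

pairOf : {N : ℕ} {x y : Fin N} → x ≢ y → ∃ λ q → Joins q x y
pairOf {x = x} {y} x≢y with Fin.<-cmp x y
... | tri< x<y _ _ = pair x y x<y , forward refl refl
... | tri≈ _ x≡y _ = ⊥-elim (x≢y x≡y)
... | tri> _ _ y<x = pair y x y<x , backward refl refl

contains⇒∈ : {N : ℕ} {q : Pair N} {S : Subset N} → contains q S ≡ true → fst q ∈ S × snd q ∈ S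
contains⇒∈ {q = q} {S} _ with Vec.lookup S (fst q) in e₁ | Vec.lookup S (snd q) in e₂
contains⇒∈ {q = q} {S} refl | true | true = lookup⇒[]= (fst q) S e₁ , lookup⇒[]= (snd q) S e₂

∈⇒contains : {N : ℕ} {q : Pair N} {S : Subset N} → fst q ∈ S → snd q ∈ S → contains q S ≡ true
∈⇒contains q₁∈S q₂∈S rewrite []=⇒lookup q₁∈S | []=⇒lookup q₂∈S = refl

module _ {N : ℕ} (G : TreeTopology N) where

  bar-nested : {S T : Subset N} {x : Fin N} → InBar G S → InBar G T → x ∈ S → x ∈ T → S ⊆ T ⊎ T ⊆ S
  bar-nested (inj₂ refl) _           _   _   = inj₂ ⊆⊤
  bar-nested (inj₁ _)    (inj₂ refl) _   _   = inj₁ ⊆⊤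
  bar-nested {S} {T} (inj₁ S∈) (inj₁ T∈) x∈S x∈T with S ≟ₛ T
  ... | yes refl = inj₁ ⊆-refl
  ... | no S≢T with laminar G S∈ T∈ S≢T
  ...   | inj₁ S⊂T          = inj₁ (proj₁ S⊂T)
  ...   | inj₂ (inj₁ T⊂S)   = inj₂ (proj₁ T⊂S)
  ...   | inj₂ (inj₂ S∩T≡∅) = ⊥-elim (S∩T≡∅ x∈S x∈T)

  bar-compare : {S T : Subset N} {x : Fin N} → InBar G S → InBar G T → x ∈ S → x ∈ T →
                S ≡ T ⊎ S ⊂ T ⊎ T ⊂ S
  bar-compare {S} {T} bS bT x∈S x∈T with S ≟ₛ T
  ... | yes S≡T = inj₁ S≡T
  ... | no S≢T with bar-nested bS bT x∈S x∈T
  ...   | inj₁ S⊆T = inj₂ (inj₁ (⊆∧≢⇒⊂ S⊆T S≢T))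
  ...   | inj₂ T⊆S = inj₂ (inj₂ (⊆∧≢⇒⊂ T⊆S (S≢T ∘ sym)))

  clade-of-⊂ : {S T : Subset N} → InBar G S → S ⊂ T → S ∈ₗ clades G
  clade-of-⊂ (inj₁ S∈)   _                 = S∈
  clade-of-⊂ (inj₂ refl) (_ , _ , _ , x∉⊤) = ⊥-elim (x∉⊤ ∈⊤)

  -- For N = 0 the upper size bound N ∸ 1 = 0 admits ⊤, so the lower one is needed.
  ⊤∉clades : ¬ (⊤ ∈ₗ clades G)
  ⊤∉clades ⊤∈ = out-of-range N (size-lo G ⊤∈) (size-hi G ⊤∈)
    where
    out-of-range : ∀ n → 2 ℕ.≤ ∣ ⊤ {n} ∣ → ¬ (∣ ⊤ {n} ∣ ℕ.≤ n ℕ.∸ 1)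
    out-of-range zero    ()
    out-of-range (suc n) _ ∣⊤∣≤n rewrite ∣⊤∣≡n (suc n) = ℕ.<-irrefl refl ∣⊤∣≤n

  bars : List (Subset N)
  bars = ⊤ ∷ clades G

  bars-unique : Unique bars
  bars-unique = All.tabulate (λ T∈ ⊤≡T → ⊤∉clades (subst (_∈ₗ clades G) (sym ⊤≡T) T∈)) ∷ unique G

  lookup-bars : ∀ i → InBar G (List.lookup bars i)
  lookup-bars zero    = inj₂ refl
  lookup-bars (suc i) = inj₁ (∈-lookup i)

  -- Generic in the decision procedure so that it applies to the filter inside cl, which Defs
  -- does not name; for the same reason the list filter _ (clades G) is passed explicitly below.
  private
    clade-through : (q : Pair N) {q⊆? : Decidable (λ S → contains q S ≡ true)} {S : Subset N} →
                    S ∈ₗ filter q⊆? (clades G) → S ∈ₗ clades G × fst q ∈ S × snd q ∈ S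
    clade-through q {q⊆?} {S} S∈ with ∈-filter⁻ q⊆? {xs = clades G} S∈
    ... | S∈G , q⊆S = S∈G , contains⇒∈ {q = q} {S} q⊆S

  ∈cl : {q : Pair N} {x y : Fin N} → Joins q x y → x ∈ cl G q
  ∈cl {q} (forward refl _)  = ∈-⋂⁺ (filter _ (clades G)) (proj₁ ∘ proj₂ ∘ clade-through q)
  ∈cl {q} (backward _ refl) = ∈-⋂⁺ (filter _ (clades G)) (proj₂ ∘ proj₂ ∘ clade-through q)

  cl-least : {q : Pair N} {x y : Fin N} {T : Subset N} → Joins q x y → InBar G T → x ∈ T → y ∈ T → cl G q ⊆ T
  cl-least _                         (inj₂ refl) _   _   = ⊆⊤
  cl-least {q} (forward refl refl)  (inj₁ T∈) x∈T y∈T = ⋂⊆ (∈-filter⁺ _ T∈ (∈⇒contains {q = q} x∈T y∈T))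
  cl-least {q} (backward refl refl) (inj₁ T∈) x∈T y∈T = ⋂⊆ (∈-filter⁺ _ T∈ (∈⇒contains {q = q} y∈T x∈T))

  cl-bar : (q : Pair N) → InBar G (cl G q)
  cl-bar q = [ inj₂ , inj₁ ∘ proj₁ ∘ clade-through q ]′ (⋂-chain (filter _ (clades G)) nested)
    where
    nested : {q⊆? : Decidable (λ S → contains q S ≡ true)} {S T : Subset N} →
             S ∈ₗ filter q⊆? (clades G) → T ∈ₗ filter q⊆? (clades G) → S ⊆ T ⊎ T ⊆ S
    nested S∈ T∈ with clade-through q S∈ | clade-through q T∈
    ... | S∈G , q₁∈S , _ | T∈G , q₁∈T , _ = bar-nested (inj₁ S∈G) (inj₁ T∈G) q₁∈S q₁∈T

  cl-isosceles : {q q′ r : Pair N} {x y z : Fin N} → Joins q x z → Joins q′ y z → Joins r x y →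
                 ¬ (cl G q ⊆ cl G r) → cl G q ≡ cl G q′
  cl-isosceles {q} {q′} {r} jq jq′ jr q⊈r = ⊆-antisym q⊆q′ q′⊆q
    where
    r⊆q′ : cl G r ⊆ cl G q′
    r⊆q′ with bar-nested (cl-bar r) (cl-bar q′) (∈cl (joins-sym jr)) (∈cl jq′)
    ... | inj₁ r⊆q′ = r⊆q′
    ... | inj₂ q′⊆r = ⊥-elim (q⊈r (cl-least jq (cl-bar r) (∈cl jr) (q′⊆r (∈cl (joins-sym jq′)))))
    r⊆q : cl G r ⊆ cl G q
    r⊆q with bar-nested (cl-bar r) (cl-bar q) (∈cl jr) (∈cl jq)
    ... | inj₁ r⊆q = r⊆q
    ... | inj₂ q⊆r = ⊥-elim (q⊈r q⊆r)
    q⊆q′ : cl G q ⊆ cl G q′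
    q⊆q′ = cl-least jq (cl-bar q′) (r⊆q′ (∈cl jr)) (∈cl (joins-sym jq′))
    q′⊆q : cl G q′ ⊆ cl G q
    q′⊆q = cl-least jq′ (cl-bar q) (r⊆q (∈cl (joins-sym jr))) (∈cl (joins-sym jq))

  SameChild : Subset N → Fin N → Fin N → Set
  SameChild S u v = u ≡ v ⊎ Any (λ T → u ∈ T × v ∈ T × T ⊂ S) (clades G)

  sameChild-via : {S T : Subset N} {u v : Fin N} → T ∈ₗ clades G → T ⊂ S → u ∈ T → v ∈ T → SameChild S u v
  sameChild-via T∈ T⊂S u∈T v∈T = inj₂ (lose T∈ (u∈T , v∈T , T⊂S))

  sameChild? : ∀ S u v → Dec (SameChild S u v)
  sameChild? S u v = u Fin.≟ v ⊎-dec any? (λ T → u ∈? T ×-dec v ∈? T ×-dec T ⊂? S) (clades G)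

  sameChild-sym : {S : Subset N} {u v : Fin N} → SameChild S u v → SameChild S v u
  sameChild-sym (inj₁ u≡v) = inj₁ (sym u≡v)
  sameChild-sym (inj₂ any) with find any
  ... | T , T∈ , u∈T , v∈T , T⊂S = sameChild-via T∈ T⊂S v∈T u∈T

  sameChild-trans : {S : Subset N} {u v t : Fin N} → SameChild S u v → SameChild S v t → SameChild S u t
  sameChild-trans (inj₁ refl) v~t         = v~t
  sameChild-trans u~v         (inj₁ refl) = u~v
  sameChild-trans (inj₂ u~v)  (inj₂ v~t) with find u~v | find v~t
  ... | T , T∈ , u∈T , v∈T , T⊂S | T′ , T′∈ , v∈T′ , t∈T′ , T′⊂S
    with bar-nested (inj₁ T∈) (inj₁ T′∈) v∈T v∈T′
  ...   | inj₁ T⊆T′ = sameChild-via T′∈ T′⊂S (T⊆T′ u∈T) t∈T′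
  ...   | inj₂ T′⊆T = sameChild-via T∈ T⊂S u∈T (T′⊆T t∈T′)

  sameChild-apart : {S : Subset N} {u v t : Fin N} → SameChild S u v → ¬ SameChild S v t → ¬ SameChild S u t
  sameChild-apart u~v ¬v~t u~t = ¬v~t (sameChild-trans (sameChild-sym u~v) u~t)

-- Full-dimensional tree topologies are binary

module _ {N : ℕ} (G : TreeTopology N) where

  ChildOf : Subset N → Fin N → Fin N → Set
  ChildOf S u x = x ∈ S × SameChild G S u x

  OutsideChildOf : Subset N → Fin N → Fin N → Set
  OutsideChildOf S u x = x ∈ S × ¬ SameChild G S u x

  record SecondChildMax (S : Subset N) (y : Fin N) : Set where
    field
      leader        : Fin N
      isMax-leader  : IsMax (_∈ S) leader
      isMax-outside : IsMax (OutsideChildOf S leader) y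

  open SecondChildMax

  secondChildMax∈ : {S : Subset N} {y : Fin N} → SecondChildMax S y → y ∈ S
  secondChildMax∈ sc = proj₁ (proj₁ (isMax-outside sc))

  leader≁secondChildMax : {S : Subset N} {y : Fin N} (sc : SecondChildMax S y) → ¬ SameChild G S (leader sc) y
  leader≁secondChildMax sc = proj₂ (proj₁ (isMax-outside sc))

  outsideChildOf-nonempty : {S : Subset N} → NonSingleton S → ∀ u → ∃ (OutsideChildOf S u)
  outsideChildOf-nonempty {S} ns u with greatest (λ T → u ∈? T ×-dec T ⊂? S) (clades G) nested
    where
    nested : ∀ {T T′} → T ∈ₗ clades G → T′ ∈ₗ clades G →
             u ∈ T × T ⊂ S → u ∈ T′ × T′ ⊂ S → T ⊆ T′ ⊎ T′ ⊆ T
    nested T∈ T′∈ (u∈T , _) (u∈T′ , _) = bar-nested G (inj₁ T∈) (inj₁ T′∈) u∈T u∈T′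
  ... | inj₂ (C , _ , (u∈C , _ , x , x∈S , x∉C) , C-greatest) = x , x∈S , ¬u~x
    where
    ¬u~x : ¬ SameChild G S u x
    ¬u~x (inj₁ refl) = x∉C u∈C
    ¬u~x (inj₂ any) with find any
    ... | T , T∈ , u∈T , x∈T , T⊂S = x∉C (C-greatest T∈ (u∈T , T⊂S) x∈T)
  ... | inj₁ none with ns u
  ...   | x , x∈S , x≢u = x , x∈S , ¬u~x
    where
    ¬u~x : ¬ SameChild G S u x
    ¬u~x (inj₁ u≡x) = x≢u (sym u≡x)
    ¬u~x (inj₂ any) with find any
    ... | T , T∈ , u∈T , _ , T⊂S = none T∈ (u∈T , T⊂S)

  secondChildMax-exists : {S : Subset N} → Nonempty S → NonSingleton S → ∃ (SecondChildMax S)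
  secondChildMax-exists {S} S≢∅ ns with maximum (_∈? S) S≢∅
  ... | M , M-max with maximum (λ x → x ∈? S ×-dec ¬? (sameChild? G S M x)) (outsideChildOf-nonempty ns M)
  ...   | y , y-max = y , record { leader = M ; isMax-leader = M-max ; isMax-outside = y-max }

  outsideChildOf<max : {S : Subset N} {M y : Fin N} → IsMax (_∈ S) M → OutsideChildOf S M y → y < M
  outsideChildOf<max (_ , M-max) (y∈S , ¬M~y) = Fin.≤∧≢⇒< (M-max _ y∈S) (¬M~y ∘ inj₁ ∘ sym)

  secondChildMax<leader : {S : Subset N} {y : Fin N} (sc : SecondChildMax S y) → y < leader sc
  secondChildMax<leader sc = outsideChildOf<max (isMax-leader sc) (proj₁ (isMax-outside sc))

  secondChildMax-unique : {S : Subset N} {y y′ : Fin N} → SecondChildMax S y → SecondChildMax S y′ → y ≡ y′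
  secondChildMax-unique sc sc′ with max-unique (isMax-leader sc) (isMax-leader sc′)
  ... | refl = max-unique (isMax-outside sc) (isMax-outside sc′)

  secondChildMax-dominates : {S S′ : Subset N} {y M : Fin N} → SecondChildMax S′ y →
                             S ∈ₗ clades G → S ⊂ S′ → y ∈ S → M ∈ S → M ≤ y
  secondChildMax-dominates {S} {S′} {y} {M} sc S∈ S⊂S′ y∈S M∈S with leader sc ∈? S
  ... | yes L∈S = ⊥-elim (leader≁secondChildMax sc (sameChild-via G S∈ S⊂S′ L∈S y∈S))
  ... | no L∉S  = proj₂ (isMax-outside sc) M (proj₁ S⊂S′ M∈S , ¬L~M)
    where
    ¬L~M : ¬ SameChild G S′ (leader sc) M
    ¬L~M (inj₁ L≡M) = L∉S (subst (_∈ S) (sym L≡M) M∈S)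
    ¬L~M (inj₂ any) with find any
    ... | T , T∈ , L∈T , M∈T , T⊂S′ with bar-nested G (inj₁ T∈) (inj₁ S∈) M∈T M∈S
    ...   | inj₁ T⊆S = L∉S (T⊆S L∈T)
    ...   | inj₂ S⊆T = leader≁secondChildMax sc (sameChild-via G T∈ T⊂S′ L∈T (S⊆T y∈S))

  secondChildMax-⊄ : {S S′ : Subset N} {y : Fin N} → InBar G S →
                     SecondChildMax S y → SecondChildMax S′ y → ¬ S ⊂ S′
  secondChildMax-⊄ bS sc sc′ S⊂S′ =
    ℕ.<⇒≱ (secondChildMax<leader sc)
          (secondChildMax-dominates sc′ (clade-of-⊂ G bS S⊂S′) S⊂S′
            (secondChildMax∈ sc) (proj₁ (isMax-leader sc)))

  secondChildMax-injective : {S S′ : Subset N} {y : Fin N} → InBar G S → InBar G S′ →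
                             SecondChildMax S y → SecondChildMax S′ y → S ≡ S′
  secondChildMax-injective bS bS′ sc sc′
    with bar-compare G bS bS′ (secondChildMax∈ sc) (secondChildMax∈ sc′)
  ... | inj₁ S≡S′        = S≡S′
  ... | inj₂ (inj₁ S⊂S′) = ⊥-elim (secondChildMax-⊄ bS sc sc′ S⊂S′)
  ... | inj₂ (inj₂ S′⊂S) = ⊥-elim (secondChildMax-⊄ bS′ sc′ sc S′⊂S)

  childMax<max : {S : Subset N} {M u y₀ : Fin N} → IsMax (_∈ S) M → ¬ SameChild G S M u →
                 IsMax (ChildOf S u) y₀ → y₀ < M
  childMax<max M-max ¬M~u ((y₀∈S , u~y₀) , _) =
    outsideChildOf<max M-max (y₀∈S , λ M~y₀ → ¬M~u (sameChild-trans G M~y₀ (sameChild-sym G u~y₀)))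

  childMax-unclaimed : {S S′ : Subset N} {y₁ u y₀ : Fin N} → InBar G S → (sc : SecondChildMax S y₁) →
                       ¬ SameChild G S (leader sc) u → ¬ SameChild G S y₁ u →
                       IsMax (ChildOf S u) y₀ → InBar G S′ → ¬ SecondChildMax S′ y₀
  childMax-unclaimed {S} {S′} {u = u} {y₀} bS sc ¬L~u ¬y₁~u ((y₀∈S , u~y₀) , y₀-max) bS′ sc′
    with bar-compare G bS bS′ y₀∈S (secondChildMax∈ sc′)
  ... | inj₁ refl =
    ¬y₁~u (sameChild-sym G (subst (SameChild G S u) (secondChildMax-unique sc′ sc) u~y₀))
  ... | inj₂ (inj₁ S⊂S′) =
    ℕ.<⇒≱ (childMax<max (isMax-leader sc) ¬L~u ((y₀∈S , u~y₀) , y₀-max))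
          (secondChildMax-dominates sc′ (clade-of-⊂ G bS S⊂S′) S⊂S′ y₀∈S (proj₁ (isMax-leader sc)))
  ... | inj₂ (inj₂ S′⊂S) =
    ℕ.<⇒≱ (secondChildMax<leader sc′) (y₀-max (leader sc′) (proj₁ S′⊂S L′∈S′ , u~L′))
    where
    L′∈S′ : leader sc′ ∈ S′
    L′∈S′ = proj₁ (isMax-leader sc′)
    u~L′ : SameChild G S u (leader sc′)
    u~L′ = sameChild-trans G u~y₀
              (sameChild-via G (clade-of-⊂ G bS′ S′⊂S) S′⊂S (secondChildMax∈ sc′) L′∈S′)

  avoid-two-children : {S : Subset N} {x y z : Fin N} → x ∈ S → y ∈ S → z ∈ S →
                       ¬ SameChild G S x y → ¬ SameChild G S y z → ¬ SameChild G S x z →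
                       ∀ a b → ∃ λ u → u ∈ S × ¬ SameChild G S a u × ¬ SameChild G S b u
  avoid-two-children {S} {x} {y} {z} x∈S y∈S z∈S ¬x~y ¬y~z ¬x~z a b
    with sameChild? G S a x | sameChild? G S b x | sameChild? G S a y | sameChild? G S b y
  ... | yes a~x | _       | _       | yes b~y = z , z∈S , sameChild-apart G a~x ¬x~z , sameChild-apart G b~y ¬y~z
  ... | yes a~x | _       | _       | no ¬b~y = y , y∈S , sameChild-apart G a~x ¬x~y , ¬b~y
  ... | no ¬a~x | no ¬b~x | _       | _       = x , x∈S , ¬a~x , ¬b~x
  ... | no ¬a~x | yes b~x | yes a~y | _       = z , z∈S , sameChild-apart G a~y ¬y~z , sameChild-apart G b~x ¬x~z
  ... | no ¬a~x | yes b~x | no ¬a~y | _       = y , y∈S , ¬a~y , sameChild-apart G b~x ¬x~y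

  fullDim⇒nonMax-claimed : FullDim G → {y₀ M : Fin N} → y₀ < M →
                           ¬ (∀ {S} → InBar G S → ¬ SecondChildMax S y₀)
  fullDim⇒nonMax-claimed fd {y₀} {M} y₀<M unclaimed with maximum (_∈? ⊤) (M , ∈⊤)
  ... | t , _ , t-max =
    ℕ.<⇒≱ (subst (λ k → 2 ℕ.+ suc k ℕ.≤ N) fd (injective-avoiding-two⇒≤ g-injective t≢y₀ g≢t g≢y₀))
          (ℕ.m≤n+m∸n N 2)
    where
    nonSingleton : ∀ i → NonSingleton (List.lookup (bars G) i)
    nonSingleton zero    = distinct⇒nonSingleton ∈⊤ ∈⊤ (Fin.<⇒≢ y₀<M)
    nonSingleton (suc i) = 2≤∣p∣⇒nonSingleton (size-lo G (∈-lookup i))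
    scm : ∀ i → ∃ (SecondChildMax (List.lookup (bars G) i))
    scm i = secondChildMax-exists (_ , proj₁ (proj₂ (nonSingleton i y₀))) (nonSingleton i)
    g : Fin (length (bars G)) → Fin N
    g i = proj₁ (scm i)
    g-injective : Injective _≡_ _≡_ g
    g-injective {i} {j} gi≡gj = lookup-injective (bars-unique G)
      (secondChildMax-injective (lookup-bars G i) (lookup-bars G j) (proj₂ (scm i))
        (subst (SecondChildMax _) (sym gi≡gj) (proj₂ (scm j))))
    g≢t : ∀ i → g i ≢ t
    g≢t i = Fin.<⇒≢ (ℕ.<-≤-trans (secondChildMax<leader (proj₂ (scm i))) (t-max _ ∈⊤))
    g≢y₀ : ∀ i → g i ≢ y₀
    g≢y₀ i gi≡y₀ = unclaimed (lookup-bars G i) (subst (SecondChildMax _) gi≡y₀ (proj₂ (scm i)))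
    t≢y₀ : t ≢ y₀
    t≢y₀ = Fin.<⇒≢ (ℕ.<-≤-trans y₀<M (t-max M ∈⊤)) ∘ sym

  fullDim⇒twoChildren : FullDim G → {S : Subset N} {a b x : Fin N} → InBar G S → a ∈ S → b ∈ S → x ∈ S →
                        ¬ SameChild G S a b → SameChild G S a x ⊎ SameChild G S b x
  fullDim⇒twoChildren fd {S} {a} {b} {x} bS a∈S b∈S x∈S ¬a~b with sameChild? G S a x | sameChild? G S b x
  ... | yes a~x | _       = inj₁ a~x
  ... | no _    | yes b~x = inj₂ b~x
  ... | no ¬a~x | no ¬b~x
    with secondChildMax-exists (a , a∈S) (distinct⇒nonSingleton a∈S b∈S (¬a~b ∘ inj₁))
  ...   | y₁ , sc with avoid-two-children a∈S b∈S x∈S ¬a~b ¬b~x ¬a~x (leader sc) y₁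
  ...   | u , u∈S , ¬L~u , ¬y₁~u with maximum (λ v → v ∈? S ×-dec sameChild? G S u v) (u , u∈S , inj₁ refl)
  ...   | y₀ , y₀-max =
    ⊥-elim (fullDim⇒nonMax-claimed fd (childMax<max (isMax-leader sc) ¬L~u y₀-max)
                                      (childMax-unclaimed bS sc ¬L~u ¬y₁~u y₀-max))

-- Closure classes under a dominated ultrametric

⊂-mono⇒⊆-mono : {n : ℕ} {P : Subset n → Set} (f : Subset n → ℚ) →
                (∀ {S T} → P S → P T → S ⊂ T → f S <ℚ f T) →
                ∀ {S T} → P S → P T → S ⊆ T → f S ≤ℚ f T
⊂-mono⇒⊆-mono f f-strict {S} {T} PS PT S⊆T with S ≟ₛ T
... | yes refl = ℚ.≤-refl
... | no S≢T   = ℚ.<⇒≤ (f-strict PS PT (⊆∧≢⇒⊂ S⊆T S≢T))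

module Ultrametric {N : ℕ} (G : TreeTopology N) (w : Vect N) (wG : InUt G w) where

  private
    c : ℚ
    c = proj₁ wG
    h : Subset N → ℚ
    h = proj₁ (proj₂ wG)
    h-strict : ∀ {S T} → InBar G S → InBar G T → S ⊂ T → h S <ℚ h T
    h-strict = proj₁ (proj₂ (proj₂ (proj₂ wG)))
    w≡ : ∀ q → w q ≡ c + (h (cl G q) + h (cl G q))
    w≡ = proj₂ (proj₂ (proj₂ (proj₂ wG)))
    h-mono : ∀ {S T} → InBar G S → InBar G T → S ⊆ T → h S ≤ℚ h T
    h-mono = ⊂-mono⇒⊆-mono h h-strict

  mono : (q r : Pair N) → cl G q ⊆ cl G r → w q ≤ℚ w r
  mono q r q⊆r = begin
    w q                             ≡⟨ w≡ q ⟩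
    c + (h (cl G q) + h (cl G q))   ≤⟨ ℚ.+-monoʳ-≤ c (ℚ.+-mono-≤ hq≤hr hq≤hr) ⟩
    c + (h (cl G r) + h (cl G r))   ≡⟨ sym (w≡ r) ⟩
    w r                             ∎
    where
    open ℚ.≤-Reasoning
    hq≤hr : h (cl G q) ≤ℚ h (cl G r)
    hq≤hr = h-mono (cl-bar G q) (cl-bar G r) q⊆r

  strict : (q r : Pair N) {T : Subset N} → InBar G T → cl G q ⊆ T → T ⊂ cl G r → w q <ℚ w r
  strict q r bT q⊆T T⊂r = begin-strict
    w q                             ≡⟨ w≡ q ⟩
    c + (h (cl G q) + h (cl G q))   <⟨ ℚ.+-monoʳ-< c (ℚ.+-mono-< hq<hr hq<hr) ⟩
    c + (h (cl G r) + h (cl G r))   ≡⟨ sym (w≡ r) ⟩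
    w r                             ∎
    where
    open ℚ.≤-Reasoning
    hq<hr : h (cl G q) <ℚ h (cl G r)
    hq<hr = ℚ.≤-<-trans (h-mono (cl-bar G q) bT q⊆T) (h-strict bT (cl-bar G r) T⊂r)

  cl-cong : (q r : Pair N) → cl G q ≡ cl G r → w q ≡ w r
  cl-cong q r q≡r = begin
    w q                             ≡⟨ w≡ q ⟩
    c + (h (cl G q) + h (cl G q))   ≡⟨ cong (λ S → c + (h S + h S)) q≡r ⟩
    c + (h (cl G r) + h (cl G r))   ≡⟨ sym (w≡ r) ⟩
    w r                             ∎
    where open ≡-Reasoning

module _ {N : ℕ} (F G : TreeTopology N) {w v : Vect N}
         (wF : InUt F w) (vG : InUt G v) (v≤w : ∀ r → v r ≤ℚ w r)
         (p : Pair N) (v≡w : v p ≡ w p) where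

  private
    module W = Ultrametric F w wF
    module V = Ultrametric G v vG

  endpoints-apart : {q : Pair N} {x y : Fin N} → cl F q ≡ cl F p → Joins q x y → ¬ SameChild F (cl F p) x y
  endpoints-apart _ jq (inj₁ x≡y) = joins⇒≢ jq x≡y
  endpoints-apart {q} q≈p jq (inj₂ any) with find any
  ... | T , T∈ , x∈T , y∈T , T⊂S =
    ⊂-irref refl (⊆-⊂-trans (cl-least F jq (inj₁ T∈) x∈T y∈T) (subst (T ⊂_) (sym q≈p) T⊂S))

  sameChild⇒shorter : {r : Pair N} {x y : Fin N} → SameChild F (cl F p) x y → Joins r x y → w r <ℚ w p
  sameChild⇒shorter (inj₁ x≡y) jr = ⊥-elim (joins⇒≢ jr x≡y)
  sameChild⇒shorter {r} (inj₂ any) jr with find any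
  ... | T , T∈ , x∈T , y∈T , T⊂S = W.strict r p (inj₁ T∈) (cl-least F jr (inj₁ T∈) x∈T y∈T) T⊂S

  move-within-child : {q q′ : Pair N} {x y z : Fin N} → Joins q x z → Joins q′ y z →
                      SameChild F (cl F p) x y → cl G q ≡ cl G p → cl G q′ ≡ cl G p
  move-within-child {q} {q′} {x} {y} jq jq′ x~y q≈p with x Fin.≟ y
  ... | yes refl = subst (λ s → cl G s ≡ cl G p) (joins-injective jq jq′) q≈p
  ... | no x≢y with pairOf x≢y
  ...   | r , jr = trans (sym (cl-isosceles G jq jq′ jr q⊈r)) q≈p
    where
    vr<vq : v r <ℚ v q
    vr<vq = begin-strict
      v r  ≤⟨ v≤w r ⟩
      w r  <⟨ sameChild⇒shorter x~y jr ⟩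
      w p  ≡⟨ sym v≡w ⟩
      v p  ≡⟨ V.cl-cong p q (sym q≈p) ⟩
      v q  ∎
      where open ℚ.≤-Reasoning
    q⊈r : ¬ (cl G q ⊆ cl G r)
    q⊈r q⊆r = ℚ.<-irrefl refl (ℚ.<-≤-trans vr<vq (V.mono q r q⊆r))

  move-both-endpoints : {q : Pair N} {a′ b′ : Fin N} → Joins q a′ b′ →
                        SameChild F (cl F p) (fst p) a′ → SameChild F (cl F p) (snd p) b′ → cl G q ≡ cl G p
  move-both-endpoints {a′ = a′} jq a~a′ b~b′ with pairOf a′≢b
    where
    a′≢b : a′ ≢ snd p
    a′≢b a′≡b = endpoints-apart refl (joins-self p) (subst (SameChild F _ (fst p)) a′≡b a~a′)
  ... | p′ , jp′ =
    move-within-child (joins-sym jp′) (joins-sym jq) b~b′ (move-within-child (joins-self p) jp′ a~a′ refl)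

  classInside : FullDim F → ClassInside F G p
  classInside fd q q≈p
    with fullDim⇒twoChildren F fd (cl-bar F p) a∈S b∈S a′∈S ¬a~b
       | fullDim⇒twoChildren F fd (cl-bar F p) a∈S b∈S b′∈S ¬a~b
    where
    a∈S : fst p ∈ cl F p
    a∈S = ∈cl F (joins-self p)
    b∈S : snd p ∈ cl F p
    b∈S = ∈cl F (joins-sym (joins-self p))
    a′∈S : fst q ∈ cl F p
    a′∈S = subst (fst q ∈_) q≈p (∈cl F (joins-self q))
    b′∈S : snd q ∈ cl F p
    b′∈S = subst (snd q ∈_) q≈p (∈cl F (joins-sym (joins-self q)))
    ¬a~b : ¬ SameChild F (cl F p) (fst p) (snd p)
    ¬a~b = endpoints-apart refl (joins-self p)
  ... | inj₁ a~a′ | inj₂ b~b′ = move-both-endpoints (joins-self q) a~a′ b~b′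
  ... | inj₂ b~a′ | inj₁ a~b′ = move-both-endpoints (joins-sym (joins-self q)) a~b′ b~a′
  ... | inj₁ a~a′ | inj₁ a~b′ =
    ⊥-elim (endpoints-apart q≈p (joins-self q) (sameChild-trans F (sameChild-sym F a~a′) a~b′))
  ... | inj₂ b~a′ | inj₂ b~b′ =
    ⊥-elim (endpoints-apart q≈p (joins-self q) (sameChild-trans F (sameChild-sym F b~a′) b~b′))

-- Only F has to be full dimensional.
theorem4p14 : (N : ℕ) (F₁ F₂ F : TreeTopology N) →
    FullDim F₁ → FullDim F₂ → FullDim F →
    InC F F₁ F₂ →
    ∀ (p : Pair N) → ClassInside F F₁ p ⊎ ClassInside F F₂ p
theorem4p14 N F₁ F₂ F _ _ fd (w₁ , w₂ , w₁∈ut , w₂∈ut , w∈ut) p with ℚ.⊔-sel (w₁ p) (w₂ p)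
... | inj₁ w₁-wins =
  inj₁ (classInside F F₁ w∈ut w₁∈ut (λ r → ℚ.p≤p⊔q (w₁ r) (w₂ r)) p (sym w₁-wins) fd)
... | inj₂ w₂-wins =
  inj₂ (classInside F F₂ w∈ut w₂∈ut (λ r → ℚ.p≤q⊔p (w₁ r) (w₂ r)) p (sym w₂-wins) fd)
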